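{- For every $\alpha\in\mathrm{ord}$ there exists $\beta\in\mathrm{ord}$ such that $\alpha=_{\mathrm{Ord}}\beta$ and $\beta$ is filtering.
   Context: The setting is constructive. Let $\mathfrak F$ be a set of index sets containing $\mathbb N$ and every $\mathbb N_k=\{n\in\mathbb N:n<k\}$, closed (up to isomorphism) under finitely enumerated subsets, sets of finitely enumerated subsets, and disjoint unions indexed by elements of $\mathfrak F$. The set $\mathrm{ord}=\mathrm{ord}_{\mathfrak F}$ is defined inductively: a distinguished element $\underline 0$, and for every $I\in\mathfrak F$ and family $(\alpha_i)_{i\in I}$ in $\mathrm{ord}$ an element $\mathrm S(\alpha_i)_{i\in I}$; $\mathrm{ord}^*$ is the set of these. For $\alpha=\mathrm S(\alpha_i)_{i\in I}$, $\mathrm{In}_\alpha=I$; by convention $\mathrm{In}_{\underline0}=\emptyset$. For a finite list $F\subseteq_f\mathrm{In}_\alpha$, $\alpha_F$ is the list of the $\alpha_i$, $i\in F$. By simultaneous induction ($m\ge1$): $\alpha\le\beta^1,\dots,\beta^m$ means $\alpha_i<\beta^1,\dots,\beta^m$ for all $i\in\mathrm{In}_\alpha$; $\alpha<\beta^1,\dots,\beta^m$ means there exist $F_k\subseteq_f\mathrm{In}_{\beta^k}$, not all empty, with $\alpha\le\beta^1_{F_1},\dots,\beta^m_{F_m}$; $m=1$ gives binary $\le,<$. $\alpha=_{\mathrm{Ord}}\beta$ means $\alpha\le\beta$ and $\beta\le\alpha$. For $(\alpha^j)_{j\in J}$ in $\mathrm{ord}^*$ with $\alpha^j=\mathrm S((\alpha^j)_i)_{i\in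 I_j}$, $\sup(\alpha^j)_{j\in J}=\mathrm S(\varepsilon_k)_{k\in K}$ with $K$ the disjoint union of the $I_j$ and $\varepsilon_k=(\alpha^j)_i$ when $k$ is the image of $i\in I_j$; for a finite family in $\mathrm{ord}$, $\sup(\alpha^1,\dots,\alpha^r)$ is $\underline0$ if all are $\underline0$, else the sup of those in $\mathrm{ord}^*$ (and the sup of the empty family is $\underline 0$). An element $\beta=\mathrm S(\beta_i)_{i\in\mathrm{In}_\beta}\in\mathrm{ord}$ is filtering if for each finitely enumerated $F\subseteq\mathrm{In}_\beta$ there exists $j\in\mathrm{In}_\beta$ with $\sup(\beta_i)_{i\in F}\le\beta_j$. -}

module Defs where

open import Data.Nat using (ℕ)
open import Data.Fin using (Fin)
open import Data.Empty using (⊥)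
open import Data.Unit using (⊤)
open import Data.Product using (Σ; _×_; _,_; proj₁; proj₂)
open import Data.Sum using (_⊎_)
open import Data.List using (List; []; _∷_; _++_; map; length; lookup)
open import Data.List.Membership.Propositional using (_∈_)
open import Relation.Binary.PropositionalEquality using (_≡_)
open import Relation.Nullary using (¬_)
open import Function.Bundles using (_↔_; Inverse)

-- The collection 𝔉 of index sets, presented as a (Tarski-style) universe:
-- codes U with decoding El.
-- A finitely enumerated subset of I is given by a finite list l of
-- elements of I (the subset { i ∈ I | i ∈ l }); the set of finitely
-- enumerated subsets of I is represented by the set of such lists.
record IndexFamily : Set₁ where
  field
    U     : Set
    El    : U → Set
    nat   : U
    natEl : El nat ↔ ℕ
    fin   : ℕ → U
    finEl : (k : ℕ) → El (fin k) ↔ Fin k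
    sub   : (I : U) → List (El I) → U
    subEl : (I : U) (l : List (El I)) → El (sub I l) ↔ Σ (El I) (λ i → i ∈ l)
    fsubs   : U → U
    fsubsEl : (I : U) → El (fsubs I) ↔ List (El I)
    sig   : (I : U) → (El I → U) → U
    sigEl : (I : U) (K : El I → U) → El (sig I K) ↔ Σ (El I) (λ i → El (K i))

module _ (𝔉 : IndexFamily) where
  open IndexFamily 𝔉

  data Ord : Set where
    𝟘 : Ord
    S : (I : U) → (El I → Ord) → Ord

  In : Ord → Set
  In 𝟘       = ⊥
  In (S I f) = El I

  comp : (α : Ord) → In α → Ord
  comp (S I f) i = f i

  compL : (α : Ord) → List (In α) → List Ord
  compL α F = map (comp α) F

  Sel : List Ord → Set
  Sel []       = ⊤
  Sel (β ∷ βs) = List (In β) × Sel βs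

  pick : (βs : List Ord) → Sel βs → List Ord
  pick []       _        = []
  pick (β ∷ βs) (F , Fs) = compL β F ++ pick βs Fs

  SomeNonEmpty : (βs : List Ord) → Sel βs → Set
  SomeNonEmpty []       _        = ⊥
  SomeNonEmpty (β ∷ βs) (F , Fs) = (¬ F ≡ []) ⊎ SomeNonEmpty βs Fs

  mutual
    _≤*_ : Ord → List Ord → Set
    𝟘     ≤* γs = ⊤
    S I f ≤* γs = (i : El I) → f i <* γs

    _<*_ : Ord → List Ord → Set
    α <* βs = Σ (Sel βs) (λ Fs → SomeNonEmpty βs Fs × (α ≤* pick βs Fs))

  _≤o_ : Ord → Ord → Set
  α ≤o β = α ≤* (β ∷ [])

  _<o_ : Ord → Ord → Set
  α <o β = α <* (β ∷ [])

  _=Ord_ : Ord → Ord → Set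
  α =Ord β = (α ≤o β) × (β ≤o α)

  starParts : List Ord → List (Σ U (λ I → El I → Ord))
  starParts []            = []
  starParts (𝟘 ∷ αs)      = starParts αs
  starParts (S I f ∷ αs)  = (I , f) ∷ starParts αs

  supStar : List (Σ U (λ I → El I → Ord)) → Ord
  supStar [] = 𝟘
  supStar ps@(_ ∷ _) =
    S (sig (fin n) K) (λ k → val (Inverse.to (sigEl (fin n) K) k))
    where
    n : ℕ
    n = length ps
    at : El (fin n) → Σ U (λ I → El I → Ord)
    at c = lookup ps (Inverse.to (finEl n) c)
    K : El (fin n) → U
    K c = proj₁ (at c)
    val : Σ (El (fin n)) (λ c → El (K c)) → Ord
    val (c , i) = proj₂ (at c) i

  -- sup(α^1,…,α^r): 𝟘 if all are 𝟘 (or r = 0), else the sup of those in ord*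
  supL : List Ord → Ord
  supL αs = supStar (starParts αs)

  Filtering : Ord → Set
  Filtering β = (F : List (In β)) → ¬ F ≡ [] →
                Σ (In β) (λ j → supL (compL β F) ≤o comp β j)

-- For α = S(α_i)_{i ∈ I}, take β whose components are the sups of the non-empty
-- finite subfamilies of (α_i). Each α_i lies below the sup of {α_i}, and each such
-- sup lies below α, so α =Ord β. Finitely many components of β are dominated by the
-- sup over the union of their subfamilies, so β is filtering. What makes this work
-- is that the components of sup L are exactly the components of the members of L,
-- together with monotonicity of α ≤ β^1,…,β^m in the list β^1,…,β^m.
module Submission where

open import Data.Empty using (⊥-elim)
open import Data.Nat using (ℕ)
open import Data.List using (List; []; _∷_; _++_; map; length; lookup; concatMap)
open import Data.List.Properties using (map-++)
open import Data.List.Relation.Unary.Any as Any using (Any; here; there)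
open import Data.List.Relation.Unary.Any.Properties using (lookup-index)
open import Data.List.Membership.Propositional using (_∈_; find; lose)
open import Data.List.Membership.Propositional.Properties
  using (∈-++⁺ˡ; ∈-++⁺ʳ; ∈-++⁻; ∈-map⁻; ∈-lookup; ∈-concatMap⁺)
open import Data.List.Relation.Binary.Subset.Propositional using (_⊆_)
open import Data.List.Relation.Binary.Subset.Propositional.Properties
  using (⊆-trans; ⊆-reflexive; xs⊆xs++ys; xs⊆ys++xs; ++⁺; map⁺; Any-resp-⊆)
open import Data.Product using (Σ; _×_; _,_; proj₁; proj₂)
open import Data.Sum using (inj₁; inj₂)
open import Data.Unit using (tt)
open import Function.Base using (_∘′_)
open import Function.Bundles using (Inverse)
open import Relation.Binary.PropositionalEquality using (_≡_; refl; sym; trans; cong; subst)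
open import Relation.Nullary using (¬_)

open import Defs using (IndexFamily; 𝟘; S)
import Defs as D

module Ordinals (𝔉 : IndexFamily) where
  open IndexFamily 𝔉

  Ord : Set
  Ord = D.Ord 𝔉

  In : Ord → Set
  In = D.In 𝔉

  comp : (α : Ord) → In α → Ord
  comp = D.comp 𝔉

  compL : (α : Ord) → List (In α) → List Ord
  compL = D.compL 𝔉

  Sel : List Ord → Set
  Sel = D.Sel 𝔉

  pick : (βs : List Ord) → Sel βs → List Ord
  pick = D.pick 𝔉

  SomeNonEmpty : (βs : List Ord) → Sel βs → Set
  SomeNonEmpty = D.SomeNonEmpty 𝔉

  _≤*_ _<*_ : Ord → List Ord → Set
  _≤*_ = D._≤*_ 𝔉
  _<*_ = D._<*_ 𝔉

  _≤o_ _<o_ : Ord → Ord → Set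
  _≤o_ = D._≤o_ 𝔉
  _<o_ = D._<o_ 𝔉

  Part : Set
  Part = Σ U (λ I → El I → Ord)

  toOrd : Part → Ord
  toOrd p = S (proj₁ p) (proj₂ p)

  supStar : List Part → Ord
  supStar = D.supStar 𝔉

  starParts : List Ord → List Part
  starParts = D.starParts 𝔉

  supL : List Ord → Ord
  supL = D.supL 𝔉

  Filtering : Ord → Set
  Filtering = D.Filtering 𝔉

  _isCompOf_ : Ord → Ord → Set
  x isCompOf δ = Σ (In δ) (λ i → comp δ i ≡ x)

  _∈Comps_ : Ord → List Ord → Set
  x ∈Comps δs = Any (x isCompOf_) δs

  ≤*-intro : (α : Ord) {δs : List Ord} → ((i : In α) → comp α i <* δs) → α ≤* δs
  ≤*-intro 𝟘       _ = tt
  ≤*-intro (S I f) h = h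

  ≤*-comp : (α : Ord) {δs : List Ord} → α ≤* δs → (i : In α) → comp α i <* δs
  ≤*-comp (S I f) h = h

  noneSel : (δs : List Ord) → Sel δs
  noneSel []       = tt
  noneSel (δ ∷ δs) = [] , noneSel δs

  _⊕_ : {δs : List Ord} → Sel δs → Sel δs → Sel δs
  _⊕_ {[]}     _        _        = tt
  _⊕_ {δ ∷ δs} (F , Fs) (G , Gs) = F ++ G , Fs ⊕ Gs

  pick-⊕ˡ : (δs : List Ord) (Fs Gs : Sel δs) → pick δs Fs ⊆ pick δs (Fs ⊕ Gs)
  pick-⊕ˡ []       _        _        ()
  pick-⊕ˡ (δ ∷ δs) (F , Fs) (G , Gs) =
    ++⁺ (⊆-trans (xs⊆xs++ys (compL δ F) (compL δ G))
                 (⊆-reflexive (sym (map-++ (comp δ) F G))))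
        (pick-⊕ˡ δs Fs Gs)

  pick-⊕ʳ : (δs : List Ord) (Fs Gs : Sel δs) → pick δs Gs ⊆ pick δs (Fs ⊕ Gs)
  pick-⊕ʳ []       _        _        ()
  pick-⊕ʳ (δ ∷ δs) (F , Fs) (G , Gs) =
    ++⁺ (⊆-trans (xs⊆ys++xs (compL δ G) (compL δ F))
                 (⊆-reflexive (sym (map-++ (comp δ) F G))))
        (pick-⊕ʳ δs Fs Gs)

  ∈pick⇒SomeNonEmpty : (δs : List Ord) (Fs : Sel δs) {x : Ord} →
                       x ∈ pick δs Fs → SomeNonEmpty δs Fs
  ∈pick⇒SomeNonEmpty (δ ∷ δs) ([]    , Fs) x∈ = inj₂ (∈pick⇒SomeNonEmpty δs Fs x∈)
  ∈pick⇒SomeNonEmpty (δ ∷ δs) (_ ∷ _ , Fs) _  = inj₁ (λ ())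

  SomeNonEmpty⇒∈pick : (δs : List Ord) (Fs : Sel δs) →
                       SomeNonEmpty δs Fs → Σ Ord (_∈ pick δs Fs)
  SomeNonEmpty⇒∈pick (δ ∷ δs) ([]    , Fs) (inj₁ F≢[]) = ⊥-elim (F≢[] refl)
  SomeNonEmpty⇒∈pick (δ ∷ δs) (i ∷ F , Fs) (inj₁ _)    = comp δ i , here refl
  SomeNonEmpty⇒∈pick (δ ∷ δs) (F     , Fs) (inj₂ ne)   =
    let x , x∈ = SomeNonEmpty⇒∈pick δs Fs ne in x , ∈-++⁺ʳ (compL δ F) x∈

  ∈pick⇒∈Comps : (δs : List Ord) (Fs : Sel δs) {x : Ord} → x ∈ pick δs Fs → x ∈Comps δs
  ∈pick⇒∈Comps (δ ∷ δs) (F , Fs) x∈ with ∈-++⁻ (compL δ F) x∈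
  ... | inj₁ x∈δF  = let i , _ , x≡ = ∈-map⁻ (comp δ) x∈δF in here (i , sym x≡)
  ... | inj₂ x∈pick = there (∈pick⇒∈Comps δs Fs x∈pick)

  ∈Comps⇒∈pick : (δs : List Ord) {x : Ord} → x ∈Comps δs →
                 Σ (Sel δs) (λ Fs → x ∈ pick δs Fs)
  ∈Comps⇒∈pick (δ ∷ δs) (here (i , refl)) = (i ∷ [] , noneSel δs) , here refl
  ∈Comps⇒∈pick (δ ∷ δs) (there x∈) =
    let Fs , x∈pick = ∈Comps⇒∈pick δs x∈ in ([] , Fs) , x∈pick

  ⊆Comps⇒⊆pick : (δs L : List Ord) → (∀ {x} → x ∈ L → x ∈Comps δs) →
                 Σ (Sel δs) (λ Fs → L ⊆ pick δs Fs)
  ⊆Comps⇒⊆pick δs []      _ = noneSel δs , λ ()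
  ⊆Comps⇒⊆pick δs (x ∷ L) h =
    let Fs , x∈Fs = ∈Comps⇒∈pick δs (h (here refl))
        Gs , L⊆Gs = ⊆Comps⇒⊆pick δs L (λ y∈ → h (there y∈))
    in Fs ⊕ Gs , λ { (here refl) → pick-⊕ˡ δs Fs Gs x∈Fs
                   ; (there y∈)  → pick-⊕ʳ δs Fs Gs (L⊆Gs y∈) }

  mutual
    ≤*-mono : (α : Ord) {γs δs : List Ord} → γs ⊆ δs → α ≤* γs → α ≤* δs
    ≤*-mono 𝟘       _   _   = tt
    ≤*-mono (S I f) γ⊆δ α≤ i = <*-mono (f i) γ⊆δ (α≤ i)

    -- Every member of the selection from γs is a component of some δ ∈ δs, so one
    -- selection from δs covers them all; it is non-empty since the first one is.
    <*-mono : (α : Ord) {γs δs : List Ord} → γs ⊆ δs → α <* γs → α <* δs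
    <*-mono α {γs} {δs} γ⊆δ (Fs , ne , α≤) =
      let x , x∈ = SomeNonEmpty⇒∈pick γs Fs ne
          Gs , picked⊆ = ⊆Comps⇒⊆pick δs (pick γs Fs)
                           (λ y∈ → Any-resp-⊆ γ⊆δ (∈pick⇒∈Comps γs Fs y∈))
      in Gs , ∈pick⇒SomeNonEmpty δs Gs (picked⊆ x∈) , ≤*-mono α picked⊆ α≤

  ≤o-refl : (α : Ord) → α ≤o α
  ≤o-refl 𝟘       = tt
  ≤o-refl (S I f) i = (i ∷ [] , tt) , inj₁ (λ ()) , ≤o-refl (f i)

  ∈⇒≤* : {α : Ord} {δs : List Ord} → α ∈ δs → α ≤* δs
  ∈⇒≤* {α} α∈ = ≤*-mono α (λ { (here refl) → α∈ }) (≤o-refl α)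

  ≤o-comp⇒<o : {α : Ord} (δ : Ord) (i : In δ) → α ≤o comp δ i → α <o δ
  ≤o-comp⇒<o _ i α≤ = (i ∷ [] , tt) , inj₁ (λ ()) , α≤

  isCompOf⇒<o : {α δ : Ord} → α isCompOf δ → α <o δ
  isCompOf⇒<o {δ = δ} (i , refl) = ≤o-comp⇒<o δ i (≤o-refl (comp δ i))

  compsOf⇒≤o : (α : Ord) {δ : Ord} → ((i : In α) → comp α i isCompOf δ) → α ≤o δ
  compsOf⇒≤o α {δ} h = ≤*-intro α (λ i → isCompOf⇒<o {δ = δ} (h i))

  supStar-comp⁻ : (ps : List Part) (k : In (supStar ps)) →
                  Any ((comp (supStar ps) k isCompOf_) ∘′ toOrd) ps
  supStar-comp⁻ ps@(_ ∷ _) k =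
    let c , i = Inverse.to (sigEl (fin (length ps)) _) k
    in lose (∈-lookup (Inverse.to (finEl (length ps)) c)) (i , refl)

  supStar-comp⁺ : (ps : List Part) {x : Ord} →
                  Any ((x isCompOf_) ∘′ toOrd) ps → x isCompOf supStar ps
  supStar-comp⁺ ps@(_ ∷ _) {x} x∈ =
    Inverse.from (sigEl (fin n) K) (c , i) ,
    trans (cong (λ q → proj₂ (at (proj₁ q)) (proj₂ q))
                (Inverse.strictlyInverseˡ (sigEl (fin n) K) (c , i)))
          i↦x
    where
    n : ℕ
    n = length ps
    at : El (fin n) → Part
    at c = lookup ps (Inverse.to (finEl n) c)
    K : El (fin n) → U
    K c = proj₁ (at c)
    c : El (fin n)
    c = Inverse.from (finEl n) (Any.index x∈)
    at-c : at c ≡ lookup ps (Any.index x∈)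
    at-c = cong (lookup ps) (Inverse.strictlyInverseˡ (finEl n) (Any.index x∈))
    x-at-c : x isCompOf toOrd (at c)
    x-at-c = subst ((x isCompOf_) ∘′ toOrd) (sym at-c) (lookup-index x∈)
    i : El (K c)
    i = proj₁ x-at-c
    i↦x : proj₂ (at c) i ≡ x
    i↦x = proj₂ x-at-c

  starParts-comp⁺ : (L : List Ord) {x : Ord} →
                    x ∈Comps L → Any ((x isCompOf_) ∘′ toOrd) (starParts L)
  starParts-comp⁺ (𝟘     ∷ L) (here (() , _))
  starParts-comp⁺ (𝟘     ∷ L) (there x∈) = starParts-comp⁺ L x∈
  starParts-comp⁺ (S I f ∷ L) (here x∈)  = here x∈
  starParts-comp⁺ (S I f ∷ L) (there x∈) = there (starParts-comp⁺ L x∈)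

  starParts-comp⁻ : (L : List Ord) {x : Ord} →
                    Any ((x isCompOf_) ∘′ toOrd) (starParts L) → x ∈Comps L
  starParts-comp⁻ (𝟘     ∷ L) x∈         = there (starParts-comp⁻ L x∈)
  starParts-comp⁻ (S I f ∷ L) (here x∈)  = here x∈
  starParts-comp⁻ (S I f ∷ L) (there x∈) = there (starParts-comp⁻ L x∈)

  supL-comp⁺ : (L : List Ord) {x : Ord} → x ∈Comps L → x isCompOf supL L
  supL-comp⁺ L x∈ = supStar-comp⁺ (starParts L) (starParts-comp⁺ L x∈)

  supL-comp⁻ : (L : List Ord) (k : In (supL L)) → comp (supL L) k ∈Comps L
  supL-comp⁻ L k = starParts-comp⁻ L (supStar-comp⁻ (starParts L) k)

  supL-least : (L : List Ord) {δs : List Ord} → (∀ {α} → α ∈ L → α ≤* δs) → supL L ≤* δs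
  supL-least L {δs} L≤ = ≤*-intro (supL L) λ k →
    let α , α∈ , i , i↦k = find (supL-comp⁻ L k)
    in subst (_<* δs) i↦k (≤*-comp α (L≤ α∈) i)

  supL-upper : {L : List Ord} {α : Ord} → α ∈ L → α ≤o supL L
  supL-upper {L} {α} α∈ = compsOf⇒≤o α (λ i → supL-comp⁺ L (lose α∈ (i , refl)))

  supL-mono : {L M : List Ord} → L ⊆ M → supL L ≤o supL M
  supL-mono {L} L⊆M = supL-least L (λ α∈ → supL-upper (L⊆M α∈))

  supL-<o : (δ : Ord) (F : List (In δ)) → ¬ F ≡ [] → supL (compL δ F) <o δ
  supL-<o δ []      F≢[] = ⊥-elim (F≢[] refl)
  supL-<o δ (i ∷ F) _    =
    (i ∷ F , tt) , inj₁ (λ ()) , supL-least (compL δ (i ∷ F)) (λ α∈ → ∈⇒≤* (∈-++⁺ˡ α∈))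

  module Envelope (I : U) (f : El I → Ord) where

    -- Subfamilies are indexed by non-empty lists i ∷ l: the empty one would give
    -- the component 𝟘, which is not below S I f when I is empty.
    J : U
    J = sig I (λ _ → fsubs I)

    members : El J → List (El I)
    members x =
      let i , l = Inverse.to (sigEl I (λ _ → fsubs I)) x in i ∷ Inverse.to (fsubsEl I) l

    code : El I → List (El I) → El J
    code i l = Inverse.from (sigEl I (λ _ → fsubs I)) (i , Inverse.from (fsubsEl I) l)

    members-code : (i : El I) (l : List (El I)) → members (code i l) ≡ i ∷ l
    members-code i l
      rewrite Inverse.strictlyInverseˡ (sigEl I (λ _ → fsubs I)) (i , Inverse.from (fsubsEl I) l)
            | Inverse.strictlyInverseˡ (fsubsEl I) l = refl

    envelopeComp : El J → Ord
    envelopeComp x = supL (map f (members x))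

    envelope : Ord
    envelope = S J envelopeComp

    ≤envelope : S I f ≤o envelope
    ≤envelope i = ≤o-comp⇒<o envelope (code i [])
      (subst (λ l → f i ≤o supL (map f l)) (sym (members-code i [])) (supL-upper (here refl)))

    envelope≤ : envelope ≤o S I f
    envelope≤ x = supL-<o (S I f) (members x) (λ ())

    envelope-filtering : Filtering envelope
    envelope-filtering []      F≢[] = ⊥-elim (F≢[] refl)
    envelope-filtering (x ∷ F) _    = j , supL-least (map envelopeComp (x ∷ F)) below-j
      where
      j : El J
      j = let i , l = Inverse.to (sigEl I (λ _ → fsubs I)) x
          in code i (Inverse.to (fsubsEl I) l ++ concatMap members F)
      members-j : members j ≡ concatMap members (x ∷ F)
      members-j = members-code _ _
      below-j : ∀ {α} → α ∈ map envelopeComp (x ∷ F) → α ≤o envelopeComp j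
      below-j α∈ with ∈-map⁻ envelopeComp α∈
      ... | y , y∈ , refl =
        subst (λ l → envelopeComp y ≤o supL (map f l)) (sym members-j)
              (supL-mono (map⁺ f (λ i∈ → ∈-concatMap⁺ members (lose y∈ i∈))))

open D using (Ord; _=Ord_; Filtering)

lemma4p14 : (𝔉 : IndexFamily) (α : Ord 𝔉) →
    Σ (Ord 𝔉) (λ β → _=Ord_ 𝔉 α β × Filtering 𝔉 β)
lemma4p14 𝔉 𝟘       = 𝟘 , (tt , tt) , λ { [] []≢[] → ⊥-elim ([]≢[] refl) }
lemma4p14 𝔉 (S I f) = envelope , (≤envelope , envelope≤) , envelope-filtering
  where open Ordinals.Envelope 𝔉 I f
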